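{- Let $n\ge 0$ be an integer, let $Z\in\Phi_{n,0}$ be a special symbol, and let $\delta=\deg(Z)$. Then \[ \Bigl|\Phi_Z\cap\bigcup_{d\equiv 0\pmod 4}\Phi_{n,d}\Bigr|-\Bigl|\Phi_Z\cap\bigcup_{d\equiv 2\pmod 4}\Phi_{n,d}\Bigr|=\begin{cases}1,&\text{if }\delta=0,\\ 0,&\text{if }\delta\ge 1.\end{cases} \]
   Context: A symbol is an ordered pair $\Lambda=\binom{A}{B}$ of finite subsets $A,B$ of nonnegative integers, written $\binom{a_1,\dots,a_{m_1}}{b_1,\dots,b_{m_2}}$ with $a_1>\dots>a_{m_1}$, $b_1>\dots>b_{m_2}$; write $\Lambda^*=A$, $\Lambda_*=B$. A subsymbol $\Lambda'\subset\Lambda$ means $\Lambda'^*\subset\Lambda^*$ and $\Lambda'_*\subset\Lambda_*$; then $\Lambda\smallsetminus\Lambda'=\binom{\Lambda^*\smallsetminus\Lambda'^*}{\Lambda_*\smallsetminus\Lambda'_*}$, and $\Lambda\cup\Lambda'=\binom{\Lambda^*\cup\Lambda'^*}{\Lambda_*\cup\Lambda'_*}$. The transpose is $\Lambda^{\mathrm t}=\binom{B}{A}$. The rank is $\mathrm{rk}(\Lambda)=\sum_i a_i+\sum_j b_j-\lfloor((|A|+|B|-1)/2)^2\rfloor$ and the defect is $\mathrm{def}(\Lambda)=|A|-|B|$. Symbols are considered up to the equivalence relation generated by $\binom{a_1,\dots,a_{m_1}}{b_1,\dots,b_{m_2}}\sim\binom{a_1+1,\dots,a_{m_1}+1,0}{b_1+1,\dots,b_{m_2}+1,0}$,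 which preserves rank and defect; $\Phi_{n,d}$ denotes the set of equivalence classes of symbols of rank $n$ and defect $d$ ($d\in\mathbb{Z}$). A symbol $Z=\binom{a_1,\dots,a_m}{b_1,\dots,b_m}$ of rank $n$ and defect $0$ is special if $a_1\ge b_1\ge a_2\ge b_2\ge\dots\ge a_m\ge b_m$. For such $Z$, let $Z_{\mathrm I}=Z\smallsetminus\binom{Z^*\cap Z_*}{Z^*\cap Z_*}$ (the entries occurring in only one row), and $\deg(Z)=|(Z_{\mathrm I})^*|=|(Z_{\mathrm I})_*|$. For a subsymbol $M\subset Z_{\mathrm I}$, put $\Lambda_M=(Z\smallsetminus M)\cup M^{\mathrm t}$ (switch the row of each entry of $M$), and $\Phi_Z=\{\Lambda_M\mid M\subset Z_{\mathrm I}\}$, regarded as a set of (classes of) symbols of rank $n$, with $|\Phi_Z|=2^{2\deg(Z)}$. -}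

module Defs where

open import Data.Nat as ℕ using (ℕ; zero; suc; _≥_; _∸_; _^_; _/_)
open import Data.Nat.Properties as ℕP using ()
open import Data.Integer as ℤ using (ℤ; +_; _-_)
open import Data.Integer.DivMod using (_%ℕ_)
open import Data.Nat.ListAction using (sum)
open import Data.List using (List; []; _∷_; length; filter; deduplicate; map; concatMap; _++_)
open import Data.List.Membership.DecPropositional ℕP._≟_ using (_∈?_)
open import Data.List.Properties as LP using ()
open import Data.Product using (_×_; _,_; proj₁; proj₂)
open import Data.Product.Properties as PP using ()
open import Data.Bool using (if_then_else_)
open import Relation.Nullary using (¬?; does)
open import Relation.Binary.PropositionalEquality using (_≡_)

-- A symbol (A over B): each row a finite set of naturals, stored as a
-- strictly decreasing list  a₁ > a₂ > … .
Row : Set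
Row = List ℕ

Symbol : Set
Symbol = Row × Row

_^* : Symbol → Row
(A , B) ^* = A

_₊ : Symbol → Row
(A , B) ₊ = B

data StrictDec : Row → Set where
  []  : StrictDec []
  [_] : ∀ a → StrictDec (a ∷ [])
  cons : ∀ {a b l} → a ℕ.> b → StrictDec (b ∷ l) → StrictDec (a ∷ b ∷ l)

data WeakDec : List ℕ → Set where
  []  : WeakDec []
  [_] : ∀ a → WeakDec (a ∷ [])
  cons : ∀ {a b l} → a ≥ b → WeakDec (b ∷ l) → WeakDec (a ∷ b ∷ l)

IsSymbol : Symbol → Set
IsSymbol (A , B) = StrictDec A × StrictDec B

-- rank(Λ) = Σ aᵢ + Σ bⱼ − ⌊((|A|+|B|−1)/2)²⌋
-- For k = |A|+|B| ≥ 1 this floor is ⌊(k−1)²/4⌋; for k = 0 it is ⌊1/4⌋ = 0,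
-- which agrees with ⌊(k ∸ 1)²/4⌋.
rank : Symbol → ℤ
rank (A , B) = + (sum A ℕ.+ sum B) - + (((length A ℕ.+ length B) ∸ 1) ^ 2 / 4)

defect : Symbol → ℤ
defect (A , B) = + length A - + length B

interleave : Row → Row → List ℕ
interleave [] ys = ys
interleave (x ∷ xs) ys = x ∷ interleave′ ys xs
  where
  interleave′ : Row → Row → List ℕ
  interleave′ [] xs = xs
  interleave′ (y ∷ ys) xs = y ∷ interleave xs ys

IsSpecial : Symbol → Set
IsSpecial (A , B) = (length A ≡ length B) × WeakDec (interleave A B)

_∖_ : Row → Row → Row
A ∖ B = filter (λ x → ¬? (x ∈? B)) A

_∩_ : Row → Row → Row
A ∩ B = filter (λ x → x ∈? B) A

insert : ℕ → Row → Row
insert x [] = x ∷ []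
insert x (y ∷ ys) with ℕ.compare x y
... | ℕ.less _ _    = y ∷ insert x ys
... | ℕ.equal _     = y ∷ ys
... | ℕ.greater _ _ = x ∷ y ∷ ys

_∪_ : Row → Row → Row
[] ∪ B = B
(x ∷ A) ∪ B = insert x (A ∪ B)

subsets : Row → List Row
subsets [] = [] ∷ []
subsets (x ∷ xs) = let s = subsets xs in map (x ∷_) s ++ s

ZI : Symbol → Symbol
ZI (A , B) = (A ∖ (A ∩ B) , B ∖ (A ∩ B))

deg : Symbol → ℕ
deg Z = length (ZI Z ^*)

subsymbolsOfZI : Symbol → List Symbol
subsymbolsOfZI Z =
  concatMap (λ M₁ → map (λ M₂ → (M₁ , M₂)) (subsets (ZI Z ₊))) (subsets (ZI Z ^*))

Λ : Symbol → Symbol → Symbol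
Λ (A , B) (M₁ , M₂) = ((A ∖ M₁) ∪ M₂ , (B ∖ M₂) ∪ M₁)

-- equivalence classes of symbols: the relation is generated by
-- (a₁…aₘ over b₁…bₙ) ~ (a₁+1 … aₘ+1, 0 over b₁+1 … bₙ+1, 0).
-- Canonical (reduced) representative: while both rows contain 0
-- (i.e. both end with 0), remove these zeros and subtract 1 from all entries.

dropLast0 : Row → Row
dropLast0 [] = []
dropLast0 (x ∷ []) = []
dropLast0 (x ∷ y ∷ l) = x ∷ dropLast0 (y ∷ l)

reduceN : ℕ → Symbol → Symbol
reduceN zero S = S
reduceN (suc k) (A , B) =
  if does (0 ∈? A) Data.Bool.∧ does (0 ∈? B)
  then reduceN k (map (_∸ 1) (dropLast0 A) , map (_∸ 1) (dropLast0 B))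
  else (A , B)

normalize : Symbol → Symbol
normalize (A , B) = reduceN (length A) (A , B)

-- Φ_Z as a list of distinct classes (each given by its reduced representative)
ΦZ : Symbol → List Symbol
ΦZ Z = deduplicate (PP.≡-dec (LP.≡-dec ℕP._≟_) (LP.≡-dec ℕP._≟_))
                   (map (λ M → normalize (Λ Z M)) (subsymbolsOfZI Z))

countDefectMod4 : ℕ → Symbol → ℕ
countDefectMod4 r Z = length (filter (λ S → (defect S %ℕ 4) ℕP.≟ r) (ΦZ Z))

case-deg : ℕ → ℤ
case-deg zero = + 1
case-deg (suc _) = + 0

-- Write Z = (A, B), so |A| = |B|, and let M = (M₁, M₂) ⊆ Z_I.  Switching M changes the row
-- lengths to |A| − |M₁| + |M₂| and |B| − |M₂| + |M₁|, so def(Λ_M) = 2(|M₂| − |M₁|), which is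
-- ≡ 2(|M₁| + |M₂|) mod 4.  M is recovered from Λ_M (the entries of the top row of Λ_M outside A
-- are exactly M₂, and symmetrically), and a symbol is recovered from its reduced representative
-- and its size, so the 2^{2δ} classes Λ_M are pairwise distinct.  The difference to compute is
-- therefore  Σ_M (−1)^{|M₁|+|M₂|} = (Σ_{M₁ ⊆ (Z_I)^*} (−1)^{|M₁|}) (Σ_{M₂ ⊆ (Z_I)_*} (−1)^{|M₂|}),
-- and each factor is 1 if that row of Z_I is empty and 0 otherwise.

module Submission where

open import Defs
open import Data.Nat as ℕ using (ℕ; zero; suc; _+_; _*_; _∸_; _>_; _%_; s≤s)
import Data.Nat.Properties as ℕ
open import Data.Nat.DivMod using ([m+n]%n≡m%n)
open import Data.Integer as ℤ using (ℤ; +_; -[1+_]; -_; _-_; 0ℤ; 1ℤ; -1ℤ; _^_)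
import Data.Integer.Properties as ℤ
import Data.Integer.Tactic.RingSolver as ℤ-Solver
open import Data.Integer.DivMod using (_%ℕ_)
open import Data.List using (List; []; _∷_; length; filter; map; _++_; concatMap; cartesianProduct; deduplicate)
import Data.List.Properties as List
open import Data.List.Membership.Propositional using (_∈_; _∉_)
open import Data.List.Membership.Propositional.Properties
  using (∈-filter⁺; ∈-filter⁻; ∈-++⁻; ∈-map⁻; ∈-cartesianProduct⁻)
open import Data.List.Membership.DecPropositional ℕ._≟_ using (_∈?_)
open import Data.List.Relation.Binary.Subset.Propositional using (_⊆_)
open import Data.List.Relation.Binary.Disjoint.Propositional using (Disjoint; contractₗ)
open import Data.List.Relation.Unary.Any using (here; there)
open import Data.List.Relation.Unary.All as All using (All; []; _∷_)
import Data.List.Relation.Unary.All.Properties as All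
open import Data.List.Relation.Unary.AllPairs as AllPairs using (AllPairs; []; _∷_)
import Data.List.Relation.Unary.AllPairs.Properties as AllPairs
open import Data.List.Relation.Unary.Linked using (Linked; []; [-]; _∷_)
open import Data.List.Relation.Unary.Linked.Properties using (Linked⇒AllPairs)
open import Data.List.Relation.Unary.Unique.Propositional using (Unique)
import Data.List.Relation.Unary.Unique.Propositional.Properties as Unique
open import Data.Product as Product using (_×_; _,_; proj₁; proj₂; ∃-syntax)
open import Data.Sum as Sum using (_⊎_; inj₁; inj₂)
open import Data.Empty using (⊥-elim)
open import Function using (_∘_; flip)
open import Relation.Nullary using (yes; no; ¬?)
open import Relation.Unary using (Decidable)
open import Relation.Binary.Definitions using (DecidableEquality)
open import Relation.Binary.PropositionalEquality
  using (_≡_; _≢_; refl; sym; trans; cong; cong₂; subst; module ≡-Reasoning)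
open ≡-Reasoning

-- Rows as finite sets

Decreasing : Row → Set
Decreasing = AllPairs _>_

StrictDec⇒Linked : ∀ {xs} → StrictDec xs → Linked _>_ xs
StrictDec⇒Linked []           = []
StrictDec⇒Linked [ _ ]        = [-]
StrictDec⇒Linked (cons a>b s) = a>b ∷ StrictDec⇒Linked s

StrictDec⇒Decreasing : ∀ {xs} → StrictDec xs → Decreasing xs
StrictDec⇒Decreasing = Linked⇒AllPairs (flip ℕ.<-trans) ∘ StrictDec⇒Linked

Decreasing⇒Unique : ∀ {xs} → Decreasing xs → Unique xs
Decreasing⇒Unique = AllPairs.map ℕ.>⇒≢

⊆-tail : ∀ {x y xs ys} → x ≡ y → All (x >_) xs → x ∷ xs ⊆ y ∷ ys → xs ⊆ ys
⊆-tail refl x>xs x∷xs⊆y∷ys z∈xs with x∷xs⊆y∷ys (there z∈xs)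
... | here refl  = ⊥-elim (ℕ.<-irrefl refl (All.lookup x>xs z∈xs))
... | there z∈ys = z∈ys

decreasing-ext : ∀ {xs ys} → Decreasing xs → Decreasing ys → xs ⊆ ys → ys ⊆ xs → xs ≡ ys
decreasing-ext {[]}     {[]}     _ _ _ _ = refl
decreasing-ext {[]}     {_ ∷ _}  _ _ _ ys⊆xs with () ← ys⊆xs (here refl)
decreasing-ext {_ ∷ _}  {[]}     _ _ xs⊆ys _ with () ← xs⊆ys (here refl)
decreasing-ext {x ∷ xs} {y ∷ ys} (x>xs ∷ ↓xs) (y>ys ∷ ↓ys) xs⊆ys ys⊆xs =
  cong₂ _∷_ x≡y (decreasing-ext ↓xs ↓ys (⊆-tail x≡y x>xs xs⊆ys) (⊆-tail (sym x≡y) y>ys ys⊆xs))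
  where
  x≡y : x ≡ y
  x≡y with xs⊆ys (here refl) | ys⊆xs (here refl)
  ... | here x≡y   | _          = x≡y
  ... | there _    | here y≡x   = sym y≡x
  ... | there x∈ys | there y∈xs = ⊥-elim (ℕ.<-asym (All.lookup y>ys x∈ys) (All.lookup x>xs y∈xs))


∈-insert⁻ : ∀ {z} x ys → z ∈ insert x ys → z ≡ x ⊎ z ∈ ys
∈-insert⁻ x []       (here z≡x) = inj₁ z≡x
∈-insert⁻ x (y ∷ ys) z∈ with ℕ.compare x y
∈-insert⁻ x (y ∷ ys) (here z≡y) | ℕ.less _ _    = inj₂ (here z≡y)
∈-insert⁻ x (y ∷ ys) (there z∈) | ℕ.less _ _    = Sum.map₂ there (∈-insert⁻ x ys z∈)
∈-insert⁻ x (y ∷ ys) z∈         | ℕ.equal _     = inj₂ z∈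
∈-insert⁻ x (y ∷ ys) (here z≡x) | ℕ.greater _ _ = inj₁ z≡x
∈-insert⁻ x (y ∷ ys) (there z∈) | ℕ.greater _ _ = inj₂ z∈

∈-insert⁺ʳ : ∀ {z} x ys → z ∈ ys → z ∈ insert x ys
∈-insert⁺ʳ x (y ∷ ys) z∈ with ℕ.compare x y
∈-insert⁺ʳ x (y ∷ ys) (here z≡y) | ℕ.less _ _ = here z≡y
∈-insert⁺ʳ x (y ∷ ys) (there z∈) | ℕ.less _ _ = there (∈-insert⁺ʳ x ys z∈)
... | ℕ.equal _     = z∈
... | ℕ.greater _ _ = there z∈

All-insert : ∀ {P : ℕ → Set} {x} ys → P x → All P ys → All P (insert x ys)
All-insert         []       px []         = px ∷ []
All-insert {x = x} (y ∷ ys) px (py ∷ pys) with ℕ.compare x y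
... | ℕ.less _ _    = py ∷ All-insert ys px pys
... | ℕ.equal _     = py ∷ pys
... | ℕ.greater _ _ = px ∷ py ∷ pys

insert-decreasing : ∀ x {ys} → Decreasing ys → Decreasing (insert x ys)
insert-decreasing x {[]}     []           = [] ∷ []
insert-decreasing x {y ∷ ys} (y>ys ∷ ↓ys) with ℕ.compare x y
... | ℕ.less _ k    = All-insert ys (s≤s (ℕ.m≤m+n x k)) y>ys ∷ insert-decreasing x ↓ys
... | ℕ.equal _     = y>ys ∷ ↓ys
... | ℕ.greater _ k = (x>y ∷ All.map (flip ℕ.<-trans x>y) y>ys) ∷ y>ys ∷ ↓ys
  where x>y = s≤s (ℕ.m≤m+n y k)

length-insert : ∀ x ys → x ∉ ys → length (insert x ys) ≡ suc (length ys)
length-insert x []       _   = refl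
length-insert x (y ∷ ys) x∉ with ℕ.compare x y
... | ℕ.less _ _    = cong suc (length-insert x ys (x∉ ∘ there))
... | ℕ.equal _     = ⊥-elim (x∉ (here refl))
... | ℕ.greater _ _ = refl

∈-∪⁻ : ∀ {z} xs ys → z ∈ xs ∪ ys → z ∈ xs ⊎ z ∈ ys
∈-∪⁻ []       ys z∈ = inj₂ z∈
∈-∪⁻ (x ∷ xs) ys z∈ with ∈-insert⁻ x (xs ∪ ys) z∈
... | inj₁ z≡x    = inj₁ (here z≡x)
... | inj₂ z∈xs∪ys = Sum.map₁ there (∈-∪⁻ xs ys z∈xs∪ys)

∈-∪⁺ʳ : ∀ {z} xs {ys} → z ∈ ys → z ∈ xs ∪ ys
∈-∪⁺ʳ []       z∈ = z∈
∈-∪⁺ʳ (x ∷ xs) z∈ = ∈-insert⁺ʳ x _ (∈-∪⁺ʳ xs z∈)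

∪-decreasing : ∀ xs {ys} → Decreasing ys → Decreasing (xs ∪ ys)
∪-decreasing []       ↓ys = ↓ys
∪-decreasing (x ∷ xs) ↓ys = insert-decreasing x (∪-decreasing xs ↓ys)

length-∪ : ∀ {xs ys} → Decreasing xs → Disjoint xs ys → length (xs ∪ ys) ≡ length xs + length ys
length-∪ {[]}     _            _     = refl
length-∪ {x ∷ xs} {ys} (x>xs ∷ ↓xs) xs#ys =
  trans (length-insert x (xs ∪ ys) x∉xs∪ys) (cong suc (length-∪ ↓xs (contractₗ xs#ys)))
  where
  x∉xs∪ys : x ∉ xs ∪ ys
  x∉xs∪ys x∈ with ∈-∪⁻ xs ys x∈
  ... | inj₁ x∈xs = ℕ.<-irrefl refl (All.lookup x>xs x∈xs)
  ... | inj₂ x∈ys = xs#ys (here refl , x∈ys)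

length-filter-¬ : ∀ {A : Set} {P : A → Set} (P? : Decidable P) xs →
                  length (filter P? xs) + length (filter (¬? ∘ P?) xs) ≡ length xs
length-filter-¬ P? []       = refl
length-filter-¬ P? (x ∷ xs) with P? x
... | yes _ = cong suc (length-filter-¬ P? xs)
... | no  _ = trans (ℕ.+-suc _ _) (cong suc (length-filter-¬ P? xs))

⊆⇒∩≡ : ∀ {xs ys} → Decreasing xs → Decreasing ys → ys ⊆ xs → xs ∩ ys ≡ ys
⊆⇒∩≡ {xs} {ys} ↓xs ↓ys ys⊆xs = decreasing-ext (AllPairs.filter⁺ (_∈? ys) ↓xs) ↓ys
  (λ z∈ → proj₂ (∈-filter⁻ (_∈? ys) {xs = xs} z∈))
  (λ z∈ → ∈-filter⁺ (_∈? ys) (ys⊆xs z∈) z∈)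

length-∖ : ∀ {xs ys} → Decreasing xs → Decreasing ys → ys ⊆ xs → length (xs ∖ ys) + length ys ≡ length xs
length-∖ {xs} {ys} ↓xs ↓ys ys⊆xs = begin
  length (xs ∖ ys) + length ys        ≡⟨ ℕ.+-comm (length (xs ∖ ys)) _ ⟩
  length ys + length (xs ∖ ys)        ≡⟨ cong (λ zs → length zs + length (xs ∖ ys)) (⊆⇒∩≡ ↓xs ↓ys ys⊆xs) ⟨
  length (xs ∩ ys) + length (xs ∖ ys) ≡⟨ length-filter-¬ (_∈? ys) xs ⟩
  length xs                           ∎

deduplicate-unique : ∀ {X : Set} (_≟_ : DecidableEquality X) {xs} → Unique xs → deduplicate _≟_ xs ≡ xs
deduplicate-unique _≟_ {[]}     []            = refl
deduplicate-unique _≟_ {x ∷ xs} (x≢xs ∷ !xs) = cong (x ∷_) (begin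
  filter (¬? ∘ (x ≟_)) (deduplicate _≟_ xs) ≡⟨ cong (filter (¬? ∘ (x ≟_))) (deduplicate-unique _≟_ !xs) ⟩
  filter (¬? ∘ (x ≟_)) xs                   ≡⟨ List.filter-all (¬? ∘ (x ≟_)) x≢xs ⟩
  xs                                        ∎)

unique-map⁺ : ∀ {X Y : Set} (f : X → Y) {xs} → (∀ {x y} → x ∈ xs → y ∈ xs → f x ≡ f y → x ≡ y) →
              Unique xs → Unique (map f xs)
unique-map⁺ f {[]}     _         []            = []
unique-map⁺ f {x ∷ xs} injective (x≢xs ∷ !xs) =
  All.map⁺ (All.tabulate fx≢fy) ∷ unique-map⁺ f (λ x∈ y∈ → injective (there x∈) (there y∈)) !xs
  where
  fx≢fy : ∀ {y} → y ∈ xs → f x ≢ f y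
  fx≢fy y∈xs = All.lookup x≢xs y∈xs ∘ injective (here refl) (there y∈xs)

length-filter-map : ∀ {X Y : Set} {P : Y → Set} (P? : Decidable P) (f : X → Y) xs →
                    length (filter P? (map f xs)) ≡ length (filter (P? ∘ f) xs)
length-filter-map P? f []       = refl
length-filter-map P? f (x ∷ xs) with P? (f x)
... | yes _ = cong suc (length-filter-map P? f xs)
... | no  _ = length-filter-map P? f xs

length-∖-∪ : ∀ {X M N} → Decreasing X → Decreasing M → M ⊆ X → Disjoint N X →
             + length ((X ∖ M) ∪ N) ≡ + length X - + length M ℤ.+ + length N
length-∖-∪ {X} {M} {N} ↓X ↓M M⊆X N#X = begin
  + length ((X ∖ M) ∪ N)                   ≡⟨ cong +_ (length-∪ (AllPairs.filter⁺ _ ↓X) X∖M#N) ⟩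
  + length (X ∖ M) ℤ.+ + length N          ≡⟨ cong (ℤ._+ + length N) +length-∖ ⟩
  + length X - + length M ℤ.+ + length N   ∎
  where
  X∖M#N : Disjoint (X ∖ M) N
  X∖M#N (z∈X∖M , z∈N) = N#X (z∈N , proj₁ (∈-filter⁻ _ {xs = X} z∈X∖M))
  +length-∖ : + length (X ∖ M) ≡ + length X - + length M
  +length-∖ = begin
    + length (X ∖ M)                                ≡⟨ cancel (+ length (X ∖ M)) (+ length M) ⟩
    + (length (X ∖ M) + length M) - + length M      ≡⟨ cong (λ l → + l - + length M) (length-∖ ↓X ↓M M⊆X) ⟩
    + length X - + length M                         ∎
    where
    cancel : ∀ a b → a ≡ a ℤ.+ b - b
    cancel = ℤ-Solver.solve-∀

∖-∪-injectiveʳ : ∀ {X M M′ N N′} → Decreasing N → Decreasing N′ → Disjoint N X → Disjoint N′ X →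
                 (X ∖ M) ∪ N ≡ (X ∖ M′) ∪ N′ → N ≡ N′
∖-∪-injectiveʳ {X} ↓N ↓N′ N#X N′#X eq = decreasing-ext ↓N ↓N′ (⊆-of eq N#X) (⊆-of (sym eq) N′#X)
  where
  ⊆-of : ∀ {M M′ N N′} → (X ∖ M) ∪ N ≡ (X ∖ M′) ∪ N′ → Disjoint N X → N ⊆ N′
  ⊆-of {M′ = M′} {N′ = N′} eq N#X {z} z∈N with ∈-∪⁻ (X ∖ M′) N′ (subst (z ∈_) eq (∈-∪⁺ʳ (X ∖ _) z∈N))
  ... | inj₁ z∈X∖M′ = ⊥-elim (N#X (z∈N , proj₁ (∈-filter⁻ _ {xs = X} z∈X∖M′)))
  ... | inj₂ z∈N′   = z∈N′

-- Switching the entries of a subsymbol of Z_I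

Decreasing₂ : Symbol → Set
Decreasing₂ (A , B) = Decreasing A × Decreasing B

size : Symbol → ℕ
size (A , B) = length A + length B

record IsSubsymbolOfZI (Z M : Symbol) : Set where
  field
    top↓    : Decreasing (M ^*)
    bottom↓ : Decreasing (M ₊)
    top⊆    : M ^* ⊆ Z ^*
    bottom⊆ : M ₊ ⊆ Z ₊
    top#    : Disjoint (M ^*) (Z ₊)
    bottom# : Disjoint (M ₊) (Z ^*)
open IsSubsymbolOfZI

Λ-decreasing : ∀ {Z M} → IsSubsymbolOfZI Z M → Decreasing₂ (Λ Z M)
Λ-decreasing {A , B} {M₁ , M₂} M = ∪-decreasing (A ∖ M₁) (bottom↓ M) , ∪-decreasing (B ∖ M₂) (top↓ M)

Λ-injective : ∀ {Z M M′} → IsSubsymbolOfZI Z M → IsSubsymbolOfZI Z M′ → Λ Z M ≡ Λ Z M′ → M ≡ M′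
Λ-injective M M′ eq = cong₂ _,_
  (∖-∪-injectiveʳ (top↓ M) (top↓ M′) (top# M) (top# M′) (cong proj₂ eq))
  (∖-∪-injectiveʳ (bottom↓ M) (bottom↓ M′) (bottom# M) (bottom# M′) (cong proj₁ eq))

module _ {A B M₁ M₂} (↓A : Decreasing A) (↓B : Decreasing B) (M : IsSubsymbolOfZI (A , B) (M₁ , M₂)) where

  private
    a b m₁ m₂ : ℤ
    a  = + length A
    b  = + length B
    m₁ = + length M₁
    m₂ = + length M₂

    +length-Λ^* : + length (Λ (A , B) (M₁ , M₂) ^*) ≡ a - m₁ ℤ.+ m₂
    +length-Λ^* = length-∖-∪ ↓A (top↓ M) (top⊆ M) (bottom# M)

    +length-Λ₊ : + length (Λ (A , B) (M₁ , M₂) ₊) ≡ b - m₂ ℤ.+ m₁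
    +length-Λ₊ = length-∖-∪ ↓B (bottom↓ M) (bottom⊆ M) (top# M)

  size-Λ : size (Λ (A , B) (M₁ , M₂)) ≡ size (A , B)
  size-Λ = ℤ.+-injective (begin
    + size (Λ (A , B) (M₁ , M₂))              ≡⟨ cong₂ ℤ._+_ +length-Λ^* +length-Λ₊ ⟩
    (a - m₁ ℤ.+ m₂) ℤ.+ (b - m₂ ℤ.+ m₁)       ≡⟨ cancel a b m₁ m₂ ⟩
    a ℤ.+ b                                   ∎)
    where
    cancel : ∀ a b m₁ m₂ → (a - m₁ ℤ.+ m₂) ℤ.+ (b - m₂ ℤ.+ m₁) ≡ a ℤ.+ b
    cancel = ℤ-Solver.solve-∀

  -- def(Λ_M) = 2(|M₂| − |M₁|), with 4|M₁| added so that the right-hand side reads 2|M| mod 4.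
  defect-Λ : length A ≡ length B →
             defect (Λ (A , B) (M₁ , M₂)) ℤ.+ + length M₁ ℤ.* + 4 ≡ + 2 ℤ.* + size (M₁ , M₂)
  defect-Λ |A|≡|B| = begin
    defect (Λ (A , B) (M₁ , M₂)) ℤ.+ m₁ ℤ.* + 4         ≡⟨ cong₂ (λ r₁ r₂ → r₁ - r₂ ℤ.+ m₁ ℤ.* + 4) +length-Λ^* +length-Λ₊ ⟩
    (a - m₁ ℤ.+ m₂) - (b - m₂ ℤ.+ m₁) ℤ.+ m₁ ℤ.* + 4    ≡⟨ cong (λ b′ → (a - m₁ ℤ.+ m₂) - (b′ - m₂ ℤ.+ m₁) ℤ.+ m₁ ℤ.* + 4) a≡b ⟨
    (a - m₁ ℤ.+ m₂) - (a - m₂ ℤ.+ m₁) ℤ.+ m₁ ℤ.* + 4    ≡⟨ cancel a m₁ m₂ ⟩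
    + 2 ℤ.* (m₁ ℤ.+ m₂)                                ∎
    where
    a≡b = cong +_ |A|≡|B|
    cancel : ∀ a m₁ m₂ → (a - m₁ ℤ.+ m₂) - (a - m₂ ℤ.+ m₁) ℤ.+ m₁ ℤ.* + 4 ≡ + 2 ℤ.* (m₁ ℤ.+ m₂)
    cancel = ℤ-Solver.solve-∀

-- Reduced representatives

shiftRow : Row → Row
shiftRow X = map suc X ++ 0 ∷ []

shift : Symbol → Symbol
shift (A , B) = shiftRow A , shiftRow B

shiftⁿ : ℕ → Symbol → Symbol
shiftⁿ zero    S = S
shiftⁿ (suc t) S = shift (shiftⁿ t S)

length-shiftRow : ∀ X → length (shiftRow X) ≡ suc (length X)
length-shiftRow X = begin
  length (map suc X ++ 0 ∷ []) ≡⟨ List.length-++ (map suc X) ⟩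
  length (map suc X) + 1       ≡⟨ ℕ.+-comm _ 1 ⟩
  suc (length (map suc X))     ≡⟨ cong suc (List.length-map suc X) ⟩
  suc (length X)               ∎

shiftRow-decreasing⁻ : ∀ X → Decreasing (shiftRow X) → Decreasing X
shiftRow-decreasing⁻ []      _              = []
shiftRow-decreasing⁻ (x ∷ X) (x>X′ ∷ ↓X′) = unshift X x>X′ ∷ shiftRow-decreasing⁻ X ↓X′
  where
  unshift : ∀ Y → All (suc x >_) (shiftRow Y) → All (x >_) Y
  unshift []      _            = []
  unshift (y ∷ Y) (x>y ∷ x>Y) = ℕ.≤-pred x>y ∷ unshift Y x>Y

shiftRow-dropLast0 : ∀ {A} → Decreasing A → 0 ∈ A → shiftRow (map (_∸ 1) (dropLast0 A)) ≡ A
shiftRow-dropLast0 {0 ∷ []}          _                  _            = refl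
shiftRow-dropLast0 {_ ∷ []}          _                  (there ())
shiftRow-dropLast0 {0 ∷ _ ∷ _}       ((() ∷ _) ∷ _)     _
shiftRow-dropLast0 {suc a ∷ b ∷ A}   (_ ∷ ↓A)           (here ())
shiftRow-dropLast0 {suc a ∷ b ∷ A}   (_ ∷ ↓A)           (there 0∈) = cong (suc a ∷_) (shiftRow-dropLast0 ↓A 0∈)

reduceN-shiftⁿ : ∀ j S → Decreasing₂ S → ∃[ t ] shiftⁿ t (reduceN j S) ≡ S
reduceN-shiftⁿ zero    S       _          = 0 , refl
reduceN-shiftⁿ (suc j) (A , B) (↓A , ↓B) with 0 ∈? A | 0 ∈? B
... | no  _   | _       = 0 , refl
... | yes _   | no  _   = 0 , refl
... | yes 0∈A | yes 0∈B =
  let t , e = reduceN-shiftⁿ j (A′ , B′) (↓A′ , ↓B′) in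
  suc t , trans (cong shift e) (cong₂ _,_ A′≡ B′≡)
  where
  A′ = map (_∸ 1) (dropLast0 A)
  B′ = map (_∸ 1) (dropLast0 B)
  A′≡ = shiftRow-dropLast0 ↓A 0∈A
  B′≡ = shiftRow-dropLast0 ↓B 0∈B
  ↓A′ = shiftRow-decreasing⁻ A′ (subst Decreasing (sym A′≡) ↓A)
  ↓B′ = shiftRow-decreasing⁻ B′ (subst Decreasing (sym B′≡) ↓B)

defect-shiftⁿ : ∀ t S → defect (shiftⁿ t S) ≡ defect S
defect-shiftⁿ zero    S = refl
defect-shiftⁿ (suc t) S = begin
  + length (shiftRow A) - + length (shiftRow B) ≡⟨ cong₂ (λ a b → + a - + b) (length-shiftRow A) (length-shiftRow B) ⟩
  1ℤ ℤ.+ + length A - (1ℤ ℤ.+ + length B)     ≡⟨ cancel (+ length A) (+ length B) ⟩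
  defect (shiftⁿ t S)                          ≡⟨ defect-shiftⁿ t S ⟩
  defect S                                     ∎
  where
  A = shiftⁿ t S ^*
  B = shiftⁿ t S ₊
  cancel : ∀ a b → 1ℤ ℤ.+ a - (1ℤ ℤ.+ b) ≡ a - b
  cancel = ℤ-Solver.solve-∀

size-shiftⁿ : ∀ t S → size (shiftⁿ t S) ≡ t * 2 + size S
size-shiftⁿ zero    S = refl
size-shiftⁿ (suc t) S = begin
  length (shiftRow A) + length (shiftRow B) ≡⟨ cong₂ _+_ (length-shiftRow A) (length-shiftRow B) ⟩
  suc (length A) + suc (length B)           ≡⟨ cong suc (ℕ.+-suc (length A) (length B)) ⟩
  2 + size (shiftⁿ t S)                     ≡⟨ cong (λ s → 2 + s) (size-shiftⁿ t S) ⟩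
  2 + (t * 2 + size S)                      ∎
  where
  A = shiftⁿ t S ^*
  B = shiftⁿ t S ₊

normalize-shiftⁿ : ∀ S → Decreasing₂ S → ∃[ t ] shiftⁿ t (normalize S) ≡ S
normalize-shiftⁿ S@(A , _) = reduceN-shiftⁿ (length A) S

normalize-defect : ∀ {S} → Decreasing₂ S → defect (normalize S) ≡ defect S
normalize-defect {S} ↓S =
  let t , e = normalize-shiftⁿ S ↓S in trans (sym (defect-shiftⁿ t (normalize S))) (cong defect e)

-- Each shift adds 2 to the size, so the size of S fixes how often S was shifted from normalize S.
normalize-injective : ∀ {S S′} → Decreasing₂ S → Decreasing₂ S′ → size S ≡ size S′ →
                      normalize S ≡ normalize S′ → S ≡ S′
normalize-injective {S} {S′} ↓S ↓S′ |S|≡|S′| N≡N′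
  with t , e ← normalize-shiftⁿ S ↓S | t′ , e′ ← normalize-shiftⁿ S′ ↓S′ = begin
    S                        ≡⟨ e ⟨
    shiftⁿ t (normalize S)   ≡⟨ cong₂ shiftⁿ t≡t′ N≡N′ ⟩
    shiftⁿ t′ (normalize S′) ≡⟨ e′ ⟩
    S′                       ∎
  where
  t≡t′ : t ≡ t′
  t≡t′ = ℕ.*-cancelʳ-≡ t t′ 2 (ℕ.+-cancelʳ-≡ (size (normalize S)) _ _ (begin
    t * 2 + size (normalize S)       ≡⟨ size-shiftⁿ t (normalize S) ⟨
    size (shiftⁿ t (normalize S))    ≡⟨ cong size e ⟩
    size S                           ≡⟨ |S|≡|S′| ⟩
    size S′                          ≡⟨ cong size e′ ⟨
    size (shiftⁿ t′ (normalize S′))  ≡⟨ size-shiftⁿ t′ (normalize S′) ⟩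
    t′ * 2 + size (normalize S′)     ≡⟨ cong (λ N → t′ * 2 + size N) N≡N′ ⟨
    t′ * 2 + size (normalize S)      ∎))

-- Residues mod 4 and alternating sums

-- On -[1+ n ], _%ℕ_ branches on suc n % 4, which is why the small negative cases are listed.
[i+4]%ℕ4≡i%ℕ4 : ∀ i → (i ℤ.+ + 4) %ℕ 4 ≡ i %ℕ 4
[i+4]%ℕ4≡i%ℕ4 (+ n)                             = [m+n]%n≡m%n n 4
[i+4]%ℕ4≡i%ℕ4 -[1+ 0 ]                          = refl
[i+4]%ℕ4≡i%ℕ4 -[1+ 1 ]                          = refl
[i+4]%ℕ4≡i%ℕ4 -[1+ 2 ]                          = refl
[i+4]%ℕ4≡i%ℕ4 -[1+ 3 ]                          = refl
[i+4]%ℕ4≡i%ℕ4 -[1+ suc (suc (suc (suc n))) ] with suc n % 4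
... | zero  = refl
... | suc _ = refl

[i+k*4]%ℕ4≡i%ℕ4 : ∀ i k → (i ℤ.+ + k ℤ.* + 4) %ℕ 4 ≡ i %ℕ 4
[i+k*4]%ℕ4≡i%ℕ4 i zero    = cong (_%ℕ 4) (ℤ.+-identityʳ i)
[i+k*4]%ℕ4≡i%ℕ4 i (suc k) = begin
  (i ℤ.+ + suc k ℤ.* + 4) %ℕ 4       ≡⟨ cong (_%ℕ 4) (regroup i (+ k)) ⟩
  (i ℤ.+ + k ℤ.* + 4 ℤ.+ + 4) %ℕ 4   ≡⟨ [i+4]%ℕ4≡i%ℕ4 (i ℤ.+ + k ℤ.* + 4) ⟩
  (i ℤ.+ + k ℤ.* + 4) %ℕ 4           ≡⟨ [i+k*4]%ℕ4≡i%ℕ4 i k ⟩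
  i %ℕ 4                             ∎
  where
  regroup : ∀ i k → i ℤ.+ (1ℤ ℤ.+ k) ℤ.* + 4 ≡ i ℤ.+ k ℤ.* + 4 ℤ.+ + 4
  regroup = ℤ-Solver.solve-∀

[2n]%4-and-sign : ∀ n → ((2 * n) % 4 ≡ 0 × -1ℤ ^ n ≡ 1ℤ) ⊎ ((2 * n) % 4 ≡ 2 × -1ℤ ^ n ≡ -1ℤ)
[2n]%4-and-sign 0             = inj₁ (refl , refl)
[2n]%4-and-sign 1             = inj₂ (refl , refl)
[2n]%4-and-sign (suc (suc n)) =
  Sum.map (Product.map (trans residue) (trans sign)) (Product.map (trans residue) (trans sign)) ([2n]%4-and-sign n)
  where
  residue : (2 * (2 + n)) % 4 ≡ (2 * n) % 4
  residue = trans (cong (_% 4) (trans (ℕ.*-distribˡ-+ 2 2 n) (ℕ.+-comm 4 (2 * n)))) ([m+n]%n≡m%n (2 * n) 4)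
  sign : -1ℤ ^ (2 + n) ≡ -1ℤ ^ n
  sign = trans (ℤ.^-distribˡ-+-* -1ℤ 2 n) (ℤ.*-identityˡ _)

alternatingSum : ∀ {X : Set} → (X → ℕ) → List X → ℤ
alternatingSum k []       = 0ℤ
alternatingSum k (x ∷ xs) = -1ℤ ^ k x ℤ.+ alternatingSum k xs

alternatingSum-++ : ∀ {X : Set} (k : X → ℕ) xs ys →
                    alternatingSum k (xs ++ ys) ≡ alternatingSum k xs ℤ.+ alternatingSum k ys
alternatingSum-++ k []       ys = sym (ℤ.+-identityˡ _)
alternatingSum-++ k (x ∷ xs) ys =
  trans (cong (λ s → -1ℤ ^ k x ℤ.+ s) (alternatingSum-++ k xs ys)) (sym (ℤ.+-assoc (-1ℤ ^ k x) _ _))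

alternatingSum-map : ∀ {X Y : Set} (k : Y → ℕ) (f : X → Y) xs →
                     alternatingSum k (map f xs) ≡ alternatingSum (k ∘ f) xs
alternatingSum-map k f []       = refl
alternatingSum-map k f (x ∷ xs) = cong (λ s → -1ℤ ^ k (f x) ℤ.+ s) (alternatingSum-map k f xs)

alternatingSum-+ : ∀ {X : Set} n (k : X → ℕ) xs →
                   alternatingSum (λ x → n + k x) xs ≡ -1ℤ ^ n ℤ.* alternatingSum k xs
alternatingSum-+ n k []       = sym (ℤ.*-zeroʳ (-1ℤ ^ n))
alternatingSum-+ n k (x ∷ xs) = begin
  -1ℤ ^ (n + k x) ℤ.+ alternatingSum (λ x → n + k x) xs
    ≡⟨ cong₂ ℤ._+_ (ℤ.^-distribˡ-+-* -1ℤ n (k x)) (alternatingSum-+ n k xs) ⟩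
  -1ℤ ^ n ℤ.* -1ℤ ^ k x ℤ.+ -1ℤ ^ n ℤ.* alternatingSum k xs
    ≡⟨ ℤ.*-distribˡ-+ (-1ℤ ^ n) _ _ ⟨
  -1ℤ ^ n ℤ.* alternatingSum k (x ∷ xs) ∎

alternatingSum-cartesianProduct : ∀ {X Y : Set} (k : X → ℕ) (l : Y → ℕ) xs ys →
  alternatingSum (λ (x , y) → k x + l y) (cartesianProduct xs ys) ≡ alternatingSum k xs ℤ.* alternatingSum l ys
alternatingSum-cartesianProduct k l []       ys = refl
alternatingSum-cartesianProduct k l (x ∷ xs) ys = begin
  alternatingSum k+l (map (x ,_) ys ++ cartesianProduct xs ys)
    ≡⟨ alternatingSum-++ k+l (map (x ,_) ys) _ ⟩
  alternatingSum k+l (map (x ,_) ys) ℤ.+ alternatingSum k+l (cartesianProduct xs ys)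
    ≡⟨ cong₂ ℤ._+_ (alternatingSum-map k+l (x ,_) ys) (alternatingSum-cartesianProduct k l xs ys) ⟩
  alternatingSum (λ y → k x + l y) ys ℤ.+ alternatingSum k xs ℤ.* alternatingSum l ys
    ≡⟨ cong (ℤ._+ _) (alternatingSum-+ (k x) l ys) ⟩
  -1ℤ ^ k x ℤ.* alternatingSum l ys ℤ.+ alternatingSum k xs ℤ.* alternatingSum l ys
    ≡⟨ ℤ.*-distribʳ-+ (alternatingSum l ys) (-1ℤ ^ k x) _ ⟨
  alternatingSum k (x ∷ xs) ℤ.* alternatingSum l ys ∎
  where
  k+l = λ ((x , y) : _ × _) → k x + l y

alternatingSum-subsets : ∀ xs → alternatingSum length (subsets xs) ≡ case-deg (length xs)
alternatingSum-subsets []       = refl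
alternatingSum-subsets (x ∷ xs) = begin
  alternatingSum length (map (x ∷_) (subsets xs) ++ subsets xs)
    ≡⟨ alternatingSum-++ length (map (x ∷_) (subsets xs)) _ ⟩
  alternatingSum length (map (x ∷_) (subsets xs)) ℤ.+ alternatingSum length (subsets xs)
    ≡⟨ cong (ℤ._+ _) (trans (alternatingSum-map length (x ∷_) (subsets xs)) (alternatingSum-+ 1 length (subsets xs))) ⟩
  -1ℤ ℤ.* alternatingSum length (subsets xs) ℤ.+ alternatingSum length (subsets xs)
    ≡⟨ cancel (alternatingSum length (subsets xs)) ⟩
  0ℤ ∎
  where
  cancel : ∀ s → -1ℤ ℤ.* s ℤ.+ s ≡ 0ℤ
  cancel = ℤ-Solver.solve-∀

case-deg-*-idem : ∀ n → case-deg n ℤ.* case-deg n ≡ case-deg n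
case-deg-*-idem zero    = refl
case-deg-*-idem (suc _) = refl

residueCount : ∀ {X : Set} → (X → ℕ) → ℕ → List X → ℕ
residueCount r i xs = length (filter (λ x → r x ℕ.≟ i) xs)

+m-+[1+n]≡-1+[+m-+n] : ∀ m n → + m - + suc n ≡ -1ℤ ℤ.+ (+ m - + n)
+m-+[1+n]≡-1+[+m-+n] m n = shuffle (+ m) (+ n)
  where
  shuffle : ∀ i j → i - (1ℤ ℤ.+ j) ≡ -1ℤ ℤ.+ (i - j)
  shuffle = ℤ-Solver.solve-∀

signed-count : ∀ {X : Set} (r k : X → ℕ) {xs} → All (λ x → r x ≡ (2 * k x) % 4) xs →
               + residueCount r 0 xs - + residueCount r 2 xs ≡ alternatingSum k xs
signed-count r k []                     = refl
signed-count r k {x ∷ xs} (rx≡ ∷ rxs≡) with [2n]%4-and-sign (k x)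
... | inj₁ (residue , sign) rewrite trans rx≡ residue | sign =
  trans (ℤ.+-assoc 1ℤ (+ residueCount r 0 xs) (- + residueCount r 2 xs))
        (cong (ℤ._+_ 1ℤ) (signed-count r k rxs≡))
... | inj₂ (residue , sign) rewrite trans rx≡ residue | sign =
  trans (+m-+[1+n]≡-1+[+m-+n] (residueCount r 0 xs) (residueCount r 2 xs))
        (cong (ℤ._+_ -1ℤ) (signed-count r k rxs≡))

-- Subsets and the subsymbols of Z_I

subsets-⊆ : ∀ {ys} xs → ys ∈ subsets xs → ys ⊆ xs
subsets-⊆ []       (here refl) ()
subsets-⊆ (x ∷ xs) ys∈ with ∈-++⁻ (map (x ∷_) (subsets xs)) ys∈
... | inj₂ ys∈′ = there ∘ subsets-⊆ xs ys∈′
... | inj₁ x∷zs∈ with ∈-map⁻ (x ∷_) x∷zs∈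
...   | zs , zs∈ , refl = λ { (here z≡x) → here z≡x ; (there z∈zs) → there (subsets-⊆ xs zs∈ z∈zs) }

subsets-decreasing : ∀ {ys} xs → Decreasing xs → ys ∈ subsets xs → Decreasing ys
subsets-decreasing []       _             (here refl) = []
subsets-decreasing (x ∷ xs) (x>xs ∷ ↓xs) ys∈ with ∈-++⁻ (map (x ∷_) (subsets xs)) ys∈
... | inj₂ ys∈′ = subsets-decreasing xs ↓xs ys∈′
... | inj₁ x∷zs∈ with ∈-map⁻ (x ∷_) x∷zs∈
...   | zs , zs∈ , refl = All.anti-mono (subsets-⊆ xs zs∈) x>xs ∷ subsets-decreasing xs ↓xs zs∈

subsets-unique : ∀ {xs} → Unique xs → Unique (subsets xs)
subsets-unique {[]}     []            = [] ∷ []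
subsets-unique {x ∷ xs} (x∉xs ∷ !xs) =
  Unique.++⁺ (Unique.map⁺ (proj₂ ∘ List.∷-injective) (subsets-unique !xs)) (subsets-unique !xs) disjoint
  where
  disjoint : Disjoint (map (x ∷_) (subsets xs)) (subsets xs)
  disjoint (x∷zs∈ , x∷zs∈′) with ∈-map⁻ (x ∷_) x∷zs∈
  ... | _ , _ , refl = All.lookup x∉xs (subsets-⊆ xs x∷zs∈′ (here refl)) refl

concatMap-pairs≡cartesianProduct : ∀ {X Y : Set} (xs : List X) (ys : List Y) →
                                   concatMap (λ x → map (x ,_) ys) xs ≡ cartesianProduct xs ys
concatMap-pairs≡cartesianProduct []       ys = refl
concatMap-pairs≡cartesianProduct (x ∷ xs) ys = cong (map (x ,_) ys ++_) (concatMap-pairs≡cartesianProduct xs ys)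

subsymbolsOfZI≡cartesianProduct : ∀ Z → subsymbolsOfZI Z ≡ cartesianProduct (subsets (ZI Z ^*)) (subsets (ZI Z ₊))
subsymbolsOfZI≡cartesianProduct Z = concatMap-pairs≡cartesianProduct (subsets (ZI Z ^*)) (subsets (ZI Z ₊))

module _ {A B : Row} (↓A : Decreasing A) (↓B : Decreasing B) where

  private
    I = A ∩ B

    ↓I : Decreasing I
    ↓I = AllPairs.filter⁺ _ ↓A

    ↓ZI^* : Decreasing (ZI (A , B) ^*)
    ↓ZI^* = AllPairs.filter⁺ _ ↓A

    ↓ZI₊ : Decreasing (ZI (A , B) ₊)
    ↓ZI₊ = AllPairs.filter⁺ _ ↓B

    I⊆A : I ⊆ A
    I⊆A z∈I = proj₁ (∈-filter⁻ _ {xs = A} z∈I)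

    I⊆B : I ⊆ B
    I⊆B z∈I = proj₂ (∈-filter⁻ _ {xs = A} z∈I)

    ∈-ZI^*⁻ : ∀ {z} → z ∈ ZI (A , B) ^* → z ∈ A × z ∉ B
    ∈-ZI^*⁻ z∈ with z∈A , z∉I ← ∈-filter⁻ _ {xs = A} z∈ = z∈A , λ z∈B → z∉I (∈-filter⁺ _ z∈A z∈B)

    ∈-ZI₊⁻ : ∀ {z} → z ∈ ZI (A , B) ₊ → z ∈ B × z ∉ A
    ∈-ZI₊⁻ z∈ with z∈B , z∉I ← ∈-filter⁻ _ {xs = B} z∈ = z∈B , λ z∈A → z∉I (∈-filter⁺ _ z∈A z∈B)

  length-ZI : length A ≡ length B → length (ZI (A , B) ^*) ≡ length (ZI (A , B) ₊)
  length-ZI |A|≡|B| = ℕ.+-cancelʳ-≡ (length I) _ _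
    (trans (length-∖ ↓A ↓I I⊆A) (trans |A|≡|B| (sym (length-∖ ↓B ↓I I⊆B))))

  ∈-subsymbolsOfZI⁻ : ∀ {M} → M ∈ subsymbolsOfZI (A , B) → IsSubsymbolOfZI (A , B) M
  ∈-subsymbolsOfZI⁻ {M₁ , M₂} M∈
    with M₁∈ , M₂∈ ← ∈-cartesianProduct⁻ _ _ (subst (_ ∈_) (subsymbolsOfZI≡cartesianProduct (A , B)) M∈) =
    record
      { top↓    = subsets-decreasing _ ↓ZI^* M₁∈
      ; bottom↓ = subsets-decreasing _ ↓ZI₊ M₂∈
      ; top⊆    = λ z∈ → proj₁ (∈-ZI^*⁻ (subsets-⊆ _ M₁∈ z∈))
      ; bottom⊆ = λ z∈ → proj₁ (∈-ZI₊⁻ (subsets-⊆ _ M₂∈ z∈))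
      ; top#    = λ (z∈M₁ , z∈B) → proj₂ (∈-ZI^*⁻ (subsets-⊆ _ M₁∈ z∈M₁)) z∈B
      ; bottom# = λ (z∈M₂ , z∈A) → proj₂ (∈-ZI₊⁻ (subsets-⊆ _ M₂∈ z∈M₂)) z∈A
      }

  subsymbolsOfZI-unique : Unique (subsymbolsOfZI (A , B))
  subsymbolsOfZI-unique = subst Unique (sym (subsymbolsOfZI≡cartesianProduct (A , B)))
    (Unique.cartesianProduct⁺ (subsets-unique (Decreasing⇒Unique ↓ZI^*)) (subsets-unique (Decreasing⇒Unique ↓ZI₊)))

  ΦZ≡map-normalize-Λ : ΦZ (A , B) ≡ map (normalize ∘ Λ (A , B)) (subsymbolsOfZI (A , B))
  ΦZ≡map-normalize-Λ = deduplicate-unique _ (unique-map⁺ _ injective subsymbolsOfZI-unique)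
    where
    injective : ∀ {M M′} → M ∈ subsymbolsOfZI (A , B) → M′ ∈ subsymbolsOfZI (A , B) →
                normalize (Λ (A , B) M) ≡ normalize (Λ (A , B) M′) → M ≡ M′
    injective M∈ M′∈ = Λ-injective M M′ ∘ normalize-injective (Λ-decreasing M) (Λ-decreasing M′)
      (trans (size-Λ ↓A ↓B M) (sym (size-Λ ↓A ↓B M′)))
      where
      M  = ∈-subsymbolsOfZI⁻ M∈
      M′ = ∈-subsymbolsOfZI⁻ M′∈

  countDefectMod4≡residueCount : ∀ i →
    countDefectMod4 i (A , B) ≡ residueCount (λ M → defect (normalize (Λ (A , B) M)) %ℕ 4) i (subsymbolsOfZI (A , B))
  countDefectMod4≡residueCount i = trans (cong (residueCount (λ S → defect S %ℕ 4) i) ΦZ≡map-normalize-Λ)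
    (length-filter-map (λ S → defect S %ℕ 4 ℕ.≟ i) (normalize ∘ Λ (A , B)) (subsymbolsOfZI (A , B)))

  module _ (|A|≡|B| : length A ≡ length B) where

    defect-normalize-Λ-mod4 : ∀ {M} → M ∈ subsymbolsOfZI (A , B) →
                              defect (normalize (Λ (A , B) M)) %ℕ 4 ≡ (2 * size M) % 4
    defect-normalize-Λ-mod4 {M₁ , M₂} M∈ = begin
      defect (normalize Λ-M) %ℕ 4                         ≡⟨ cong (_%ℕ 4) (normalize-defect (Λ-decreasing M)) ⟩
      defect Λ-M %ℕ 4                                     ≡⟨ [i+k*4]%ℕ4≡i%ℕ4 (defect Λ-M) (length M₁) ⟨
      (defect Λ-M ℤ.+ + length M₁ ℤ.* + 4) %ℕ 4           ≡⟨ cong (_%ℕ 4) (defect-Λ ↓A ↓B M |A|≡|B|) ⟩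
      (+ 2 ℤ.* + size (M₁ , M₂)) %ℕ 4                     ≡⟨ cong (_%ℕ 4) (ℤ.pos-* 2 (size (M₁ , M₂))) ⟨
      (2 * size (M₁ , M₂)) % 4                            ∎
      where
      M = ∈-subsymbolsOfZI⁻ M∈
      Λ-M = Λ (A , B) (M₁ , M₂)

    alternatingSum-subsymbolsOfZI : alternatingSum size (subsymbolsOfZI (A , B)) ≡ case-deg (deg (A , B))
    alternatingSum-subsymbolsOfZI = begin
      alternatingSum size (subsymbolsOfZI (A , B))
        ≡⟨ cong (alternatingSum size) (subsymbolsOfZI≡cartesianProduct (A , B)) ⟩
      alternatingSum size (cartesianProduct (subsets P) (subsets Q))
        ≡⟨ alternatingSum-cartesianProduct length length (subsets P) (subsets Q) ⟩
      alternatingSum length (subsets P) ℤ.* alternatingSum length (subsets Q)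
        ≡⟨ cong₂ ℤ._*_ (alternatingSum-subsets P) (alternatingSum-subsets Q) ⟩
      case-deg (length P) ℤ.* case-deg (length Q)
        ≡⟨ cong (λ q → case-deg (length P) ℤ.* case-deg q) (length-ZI |A|≡|B|) ⟨
      case-deg (length P) ℤ.* case-deg (length P)
        ≡⟨ case-deg-*-idem (length P) ⟩
      case-deg (deg (A , B)) ∎
      where
      P = ZI (A , B) ^*
      Q = ZI (A , B) ₊

lemma3p4 : (n : ℕ) (Z : Symbol) → IsSymbol Z → IsSpecial Z → rank Z ≡ + n →
    (+ countDefectMod4 0 Z - + countDefectMod4 2 Z)
      ≡ (case-deg (deg Z))
lemma3p4 _ Z@(A , B) (A-dec , B-dec) (|A|≡|B| , _) _ = begin
  + countDefectMod4 0 Z - + countDefectMod4 2 Z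
    ≡⟨ cong₂ (λ c₀ c₂ → + c₀ - + c₂) (countDefectMod4≡residueCount ↓A ↓B 0) (countDefectMod4≡residueCount ↓A ↓B 2) ⟩
  + residueCount residue 0 (subsymbolsOfZI Z) - + residueCount residue 2 (subsymbolsOfZI Z)
    ≡⟨ signed-count residue size (All.tabulate (defect-normalize-Λ-mod4 ↓A ↓B |A|≡|B|)) ⟩
  alternatingSum size (subsymbolsOfZI Z)
    ≡⟨ alternatingSum-subsymbolsOfZI ↓A ↓B |A|≡|B| ⟩
  case-deg (deg Z) ∎
  where
  ↓A = StrictDec⇒Decreasing A-dec
  ↓B = StrictDec⇒Decreasing B-dec
  residue : Symbol → ℕ
  residue M = defect (normalize (Λ Z M)) %ℕ 4
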